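{- Let $G$ be a graph and let $M$ be a matching of $G$ that is also a strong clique of $G$, with $|M|=m\ge 2$. Let $x\in V(M)$ be such that $M$ is not $x$-special. If $x$ has a neighbor in $V(M)\setminus\{x,x'\}$, then for every $\ell\in\{1,\ldots,m-1\}$ there is an $(x,M)$-path of length $\ell$.
   Context: All graphs are finite and simple; the length of a path is its number of edges. The distance between two edges of $G$ is the distance between the corresponding vertices in the line graph of $G$; a strong clique is a set of edges with pairwise distance at most $2$. For a matching $M$, $V(M)$ is the set of endpoints of edges of $M$, and for $x\in V(M)$, $x'$ denotes the vertex with $xx'\in M$. For $x\in V(M)$, an $(x,M)$-path is a path $P$ in $G[V(M)]$ starting at $x$ such that the last edge of $P$ is not in $M$, and for all distinct $u,v\in V(P)$, if $uv\in M$ then $uv\in E(P)$. A matching $M$ is $x$-special if its edges can be written as $M=\{x_1x_1',\ldots,x_mx_m'\}$ with $x_1=x$ such that: $x_ix_j\in E(G)$ if and only if exactly one of $i,j$ equals $1$ (i.e., $x_1$ is adjacent to all $x_j$, $j\ge 2$, and no two of $x_2,\dots,x_m$ are adjacent); $x_i'x_j'\in E(G)$ for all $2\le i<j\le m$ and $x_1'$ is adjacent to no $x_j'$; and $x_ix_j'\notin E(G)$ for all $1\le i\ne j\le m$. -}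

module Defs where

open import Data.Nat using (ℕ; zero; suc; _∸_)
open import Data.Fin using (Fin; zero; suc; toℕ; inject₁)
open import Data.Bool using (Bool; T)
open import Data.Product using (Σ; ∃; _×_; _,_)
open import Data.Sum using (_⊎_)
open import Relation.Binary.PropositionalEquality using (_≡_; _≢_)
open import Relation.Nullary using (¬_)

record Graph (n : ℕ) : Set where
  field
    adj    : Fin n → Fin n → Bool
    sym    : ∀ u v → adj u v ≡ adj v u
    irrefl : ∀ u → adj u u ≡ Data.Bool.false

open Graph public

Adj : ∀ {n} → Graph n → Fin n → Fin n → Set
Adj G u v = T (adj G u v)

ShareVertex : ∀ {n} → (Fin n × Fin n) → (Fin n × Fin n) → Set
ShareVertex (a , b) (c , d) = (a ≡ c ⊎ a ≡ d) ⊎ (b ≡ c ⊎ b ≡ d)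

-- Distance between edges e and f in the line graph of G is at most 2:
-- either they are equal or adjacent in L(G) (share a vertex), or some
-- edge g of G shares a vertex with both.
EdgeDist≤2 : ∀ {n} → Graph n → (Fin n × Fin n) → (Fin n × Fin n) → Set
EdgeDist≤2 {n} G e f =
  ShareVertex e f ⊎
  Σ (Fin n) λ a → Σ (Fin n) λ b →
    Adj G a b × ShareVertex (a , b) e × ShareVertex (a , b) f

record Matching {n : ℕ} (G : Graph n) (m : ℕ) : Set where
  field
    u : Fin m → Fin n
    v : Fin m → Fin n
    isEdge : ∀ i → Adj G (u i) (v i)
    u-inj  : ∀ i j → u i ≡ u j → i ≡ j
    v-inj  : ∀ i j → v i ≡ v j → i ≡ j
    u≢v    : ∀ i j → u i ≢ v j

open Matching public

module _ {n : ℕ} {G : Graph n} {m : ℕ} (M : Matching G m) where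

  StrongClique : Set
  StrongClique = ∀ i j → EdgeDist≤2 G (u M i , v M i) (u M j , v M j)

  InVM : Fin n → Set
  InVM x = Σ (Fin m) λ i → x ≡ u M i ⊎ x ≡ v M i

  MEdge : Fin n → Fin n → Set
  MEdge x y = Σ (Fin m) λ i →
    (x ≡ u M i × y ≡ v M i) ⊎ (x ≡ v M i × y ≡ u M i)

  -- M is x-special: M = {p k q k : k ∈ Fin m} (a distinguished index o
  -- playing the role of index 1), with p o = x, and the adjacency
  -- conditions (x_i = p i, x_i' = q i).
  XSpecial : Fin n → Set
  XSpecial x = Σ (Fin m) λ o → Σ (Fin m → Fin n) λ p → Σ (Fin m → Fin n) λ q →
      (∀ k → MEdge (p k) (q k))
    × (∀ i → Σ (Fin m) λ k →
          (u M i ≡ p k × v M i ≡ q k) ⊎ (u M i ≡ q k × v M i ≡ p k))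
    × p o ≡ x
    × (∀ j → j ≢ o → Adj G (p o) (p j))
    × (∀ i j → i ≢ o → j ≢ o → i ≢ j → ¬ Adj G (p i) (p j))
    × (∀ i j → i ≢ o → j ≢ o → i ≢ j → Adj G (q i) (q j))
    × (∀ j → j ≢ o → ¬ Adj G (q o) (q j))
    × (∀ i j → i ≢ j → ¬ Adj G (p i) (q j))

  XMPath : Fin n → ℕ → Set
  XMPath x ℓ = Σ (Fin (suc ℓ) → Fin n) λ w →
      (∀ a b → w a ≡ w b → a ≡ b)
    × (∀ (i : Fin ℓ) → Adj G (w (inject₁ i)) (w (suc i)))
    × (∀ a → InVM (w a))
    × w zero ≡ x
    × (∀ (i : Fin ℓ) → toℕ i ≡ ℓ ∸ 1 → ¬ MEdge (w (inject₁ i)) (w (suc i)))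
    × (∀ a b → MEdge (w a) (w b) →
         toℕ b ≡ suc (toℕ a) ⊎ toℕ a ≡ suc (toℕ b))

-- The paths are built by induction on ℓ, as walks through the matching edges that jump from one
-- edge to a fresh one, possibly after first crossing the edge they are on. The strong clique
-- condition says that any two matching edges are joined by an edge of G, so if an endpoint c is
-- adjacent to no vertex of a matching edge f then its partner c' is. Length 1 is the edge xy.
-- Length 2 is x x' w or x z w (with w, z off the edge xx' and on distinct edges) unless neither
-- exists, and then the adjacencies forced by the strong clique condition are exactly those of an
-- x-special matching. To lengthen a path ending in c while a fresh edge f remains, step to f if c
-- sees it; otherwise reroute the last few steps through f and c', the reroute being chosen
-- according to which endpoints of f and of the matching edge a, two jumps before c, are adjacent.
-- This needs two jumps before c, so length 3 is made directly, as x z w f or as x y y' w.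
module Submission where

open import Defs hiding (sym)
open import Data.Nat using (ℕ; zero; suc; _+_; _≤_; _<_; _∸_; z≤n; s≤s) renaming (_≟_ to _≟ℕ_)
open import Data.Nat.Properties using (suc-injective; <-cmp; <-irrefl; <-trans; ≤-trans; n<1+n; n≤1+n)
open import Data.Fin using (Fin; zero; suc; toℕ; inject₁) renaming (_≟_ to _≟ᶠ_; _<_ to _<ᶠ_)
open import Data.Fin.Properties using (any?; pigeonhole; toℕ-injective; toℕ<n; toℕ-inject₁)
open import Data.Bool using (Bool; true; false; not; T)
open import Data.Bool.Properties using (not-involutive)
open import Data.Product using (Σ; ∃; ∃₂; _×_; _,_; proj₁; proj₂)
open import Data.Sum using (_⊎_; inj₁; inj₂; [_,_]′)
open import Data.Unit using (⊤; tt)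
open import Data.Empty using (⊥; ⊥-elim)
open import Function using (_∘_; id)
open import Relation.Binary.PropositionalEquality using (_≡_; _≢_; refl; sym; trans; cong; subst; ≢-sym)
open import Relation.Binary.Definitions using (tri<; tri≈; tri>)
open import Relation.Nullary using (¬_; Dec; yes; no)
open import Relation.Nullary.Decidable using (T?; map′; ¬?; _×-dec_; _⊎-dec_)

ifᵈ_then_else_ : ∀ {a b} {P : Set a} {X : Set b} → Dec P → (P → X) → (¬ P → X) → X
ifᵈ yes p then f else g = f p
ifᵈ no ¬p then f else g = g ¬p

≡-or-≡-not : ∀ s t → s ≡ t ⊎ s ≡ not t
≡-or-≡-not false false = inj₁ refl
≡-or-≡-not false true  = inj₂ refl
≡-or-≡-not true  false = inj₂ refl
≡-or-≡-not true  true  = inj₁ refl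

module _ {n : ℕ} {G : Graph n} {m : ℕ} (M : Matching G m) where

  Endpoint : Set
  Endpoint = Fin m × Bool

  vertex : Endpoint → Fin n
  vertex (i , true)  = u M i
  vertex (i , false) = v M i

  edgeOf : Endpoint → Fin m
  edgeOf = proj₁

  partner : Endpoint → Endpoint
  partner p = edgeOf p , not (proj₂ p)

  -- A record rather than a synonym, so that both endpoints can be inferred from a proof.
  infix 4 _~_ _⇝_
  record _~_ (p q : Endpoint) : Set where
    constructor ⟨_⟩
    field adjacent : Adj G (vertex p) (vertex q)
  open _~_ public

  _~?_ : ∀ p q → Dec (p ~ q)
  p ~? q = map′ ⟨_⟩ adjacent (T? (adj G (vertex p) (vertex q)))

  Adj-sym : ∀ {a b} → Adj G a b → Adj G b a
  Adj-sym {a} {b} = subst T (Graph.sym G a b)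

  ~-sym : ∀ {p q} → p ~ q → q ~ p
  ~-sym ⟨ h ⟩ = ⟨ Adj-sym h ⟩

  ~-irrefl : ∀ {p} → ¬ p ~ p
  ~-irrefl {p} ⟨ h ⟩ = subst T (irrefl G (vertex p)) h

  ~-partner : ∀ p → p ~ partner p
  ~-partner (i , true)  = ⟨ isEdge M i ⟩
  ~-partner (i , false) = ~-sym ⟨ isEdge M i ⟩

  vertex-injective : ∀ p q → vertex p ≡ vertex q → p ≡ q
  vertex-injective (i , true)  (j , true)  e = cong (_, true) (u-inj M i j e)
  vertex-injective (i , true)  (j , false) e = ⊥-elim (u≢v M i j e)
  vertex-injective (i , false) (j , true)  e = ⊥-elim (u≢v M j i (sym e))
  vertex-injective (i , false) (j , false) e = cong (_, false) (v-inj M i j e)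

  vertex∈VM : ∀ p → InVM M (vertex p)
  vertex∈VM (i , true)  = i , inj₁ refl
  vertex∈VM (i , false) = i , inj₂ refl

  endpointOn : ∀ {a i} → a ≡ u M i ⊎ a ≡ v M i → Σ Bool λ s → vertex (i , s) ≡ a
  endpointOn (inj₁ e) = true , sym e
  endpointOn (inj₂ e) = false , sym e

  endpointOf : ∀ {a} → InVM M a → Σ Endpoint λ p → vertex p ≡ a
  endpointOf (i , h) = (i , proj₁ (endpointOn h)) , proj₂ (endpointOn h)

  onBoth⇒≡ : ∀ {a i j} → a ≡ u M i ⊎ a ≡ v M i → a ≡ u M j ⊎ a ≡ v M j → i ≡ j
  onBoth⇒≡ {i = i} {j} hi hj with endpointOn hi | endpointOn hj
  ... | s , refl | t , e = cong edgeOf (vertex-injective (i , s) (j , t) (sym e))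

  onEdge : ∀ p {i} s → vertex p ≡ vertex (i , s) → edgeOf p ≡ i
  onEdge p s e = cong edgeOf (vertex-injective p (_ , s) e)

  MEdge-partner : ∀ p → MEdge M (vertex p) (vertex (partner p))
  MEdge-partner (i , true)  = i , inj₁ (refl , refl)
  MEdge-partner (i , false) = i , inj₂ (refl , refl)

  MEdge-irrefl : ∀ {a} → ¬ MEdge M a a
  MEdge-irrefl (i , inj₁ (e₁ , e₂)) = u≢v M i i (trans (sym e₁) e₂)
  MEdge-irrefl (i , inj₂ (e₁ , e₂)) = u≢v M i i (trans (sym e₂) e₁)

  MEdge⇒sameEdge : ∀ p q → MEdge M (vertex p) (vertex q) → edgeOf p ≡ edgeOf q
  MEdge⇒sameEdge p q (i , inj₁ (ep , eq)) = trans (onEdge p true ep) (sym (onEdge q false eq))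
  MEdge⇒sameEdge p q (i , inj₂ (ep , eq)) = trans (onEdge p false ep) (sym (onEdge q true eq))

  distinctEdges : ∀ p q → vertex q ≢ vertex p → ¬ MEdge M (vertex p) (vertex q) → edgeOf q ≢ edgeOf p
  distinctEdges (i , s) (.i , t) q≢p ¬pq refl with ≡-or-≡-not t s
  ... | inj₁ refl = q≢p refl
  ... | inj₂ refl = ¬pq (MEdge-partner (i , s))

  _⇝_ : Endpoint → Fin m → Set
  p ⇝ j = Σ Bool λ t → p ~ (j , t)

  _⇝?_ : ∀ p j → Dec (p ⇝ j)
  p ⇝? j = map′ [ (true ,_) , (false ,_) ]′ (λ { (true , h) → inj₁ h ; (false , h) → inj₂ h })
                (p ~? (j , true) ⊎-dec p ~? (j , false))

  ⇝-split : ∀ {p} q → p ⇝ edgeOf q → p ~ q ⊎ p ~ partner q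
  ⇝-split (j , s) (t , h) with ≡-or-≡-not t s
  ... | inj₁ refl = inj₁ h
  ... | inj₂ refl = inj₂ h

  Adj⇒⇝ : ∀ {a b i j} → a ≡ u M i ⊎ a ≡ v M i → b ≡ u M j ⊎ b ≡ v M j → Adj G a b →
                      Σ Bool λ s → (i , s) ⇝ j
  Adj⇒⇝ a∈i b∈j h with endpointOn a∈i | endpointOn b∈j
  ... | s , refl | t , refl = s , t , ⟨ h ⟩

  anyEndpoint? : {P : Endpoint → Set} → (∀ p → Dec (P p)) → Dec (∃ P)
  anyEndpoint? P? =
    map′ (λ { (j , inj₁ h) → (j , true) , h ; (j , inj₂ h) → (j , false) , h })
         (λ { ((j , true) , h) → j , inj₁ h ; ((j , false) , h) → j , inj₂ h })
         (any? λ j → P? (j , true) ⊎-dec P? (j , false))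

  module StrongCliqueFacts (sc : StrongClique M) where

    linked : ∀ i j → i ≢ j → Σ Bool λ s → (i , s) ⇝ j
    linked i j i≢j with sc i j
    ... | inj₁ (inj₁ ui∈j) = ⊥-elim (i≢j (onBoth⇒≡ (inj₁ refl) ui∈j))
    ... | inj₁ (inj₂ vi∈j) = ⊥-elim (i≢j (onBoth⇒≡ (inj₂ refl) vi∈j))
    ... | inj₂ (_ , _ , _ , inj₁ a∈i , inj₁ a∈j) = ⊥-elim (i≢j (onBoth⇒≡ a∈i a∈j))
    ... | inj₂ (_ , _ , _ , inj₂ b∈i , inj₂ b∈j) = ⊥-elim (i≢j (onBoth⇒≡ b∈i b∈j))
    ... | inj₂ (_ , _ , a~b , inj₁ a∈i , inj₂ b∈j) = Adj⇒⇝ a∈i b∈j a~b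
    ... | inj₂ (_ , _ , a~b , inj₂ b∈i , inj₁ a∈j) = Adj⇒⇝ b∈i a∈j (Adj-sym a~b)

    sees-or-partner-sees : ∀ p j → edgeOf p ≢ j → p ⇝ j ⊎ partner p ⇝ j
    sees-or-partner-sees (i , s) j i≢j with linked i j i≢j
    ... | t , h with ≡-or-≡-not t s
    ...   | inj₁ refl = inj₁ h
    ...   | inj₂ refl = inj₂ h

    sees-edge : ∀ p j → edgeOf p ≢ j → ¬ partner p ⇝ j → p ⇝ j
    sees-edge p j p≢j p'↛j = [ id , ⊥-elim ∘ p'↛j ]′ (sees-or-partner-sees p j p≢j)

    partner-sees-edge : ∀ p j → edgeOf p ≢ j → ¬ p ⇝ j → partner p ⇝ j
    partner-sees-edge p j p≢j p↛j = [ ⊥-elim ∘ p↛j , id ]′ (sees-or-partner-sees p j p≢j)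

    partner-sees : ∀ p q → edgeOf p ≢ edgeOf q → ¬ p ⇝ edgeOf q → partner p ~ q ⊎ partner p ~ partner q
    partner-sees p q p≢q p↛q = ⇝-split q (partner-sees-edge p (edgeOf q) p≢q p↛q)

    joined : ∀ {X : Set} p q → edgeOf p ≢ edgeOf q →
             (p ~ q → X) → (p ~ partner q → X) → (partner p ~ q → X) → (partner p ~ partner q → X) → X
    joined p q p≢q k₁ k₂ k₃ k₄ =
      [ [ k₁ , k₂ ]′ ∘ ⇝-split q , [ k₃ , k₄ ]′ ∘ ⇝-split q ]′ (sees-or-partner-sees p (edgeOf q) p≢q)

  infixl 5 _▷_
  data Trail : Set where
    []  : Trail
    _▷_ : Trail → Endpoint → Trail

  length : Trail → ℕ
  length []      = 0
  length (L ▷ _) = suc (length L)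

  Fresh : Fin m → Trail → Set
  Fresh i []      = ⊤
  Fresh i (L ▷ p) = Fresh i L × i ≢ edgeOf p

  fresh? : ∀ i L → Dec (Fresh i L)
  fresh? i []      = yes tt
  fresh? i (L ▷ p) = fresh? i L ×-dec ¬? (i ≟ᶠ edgeOf p)

  edgeAt : (L : Trail) → Fin (length L) → Fin m
  edgeAt (L ▷ p) zero    = edgeOf p
  edgeAt (L ▷ p) (suc k) = edgeAt L k

  fresh-or-used : ∀ i L → Fresh i L ⊎ ∃ λ k → edgeAt L k ≡ i
  fresh-or-used i [] = inj₁ tt
  fresh-or-used i (L ▷ p) with i ≟ᶠ edgeOf p | fresh-or-used i L
  ... | yes i≡p | _             = inj₂ (zero , sym i≡p)
  ... | no  i≢p | inj₁ fresh    = inj₁ (fresh , i≢p)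
  ... | no  _   | inj₂ (k , eq) = inj₂ (suc k , eq)

  freshEdge : ∀ L → length L < m → ∃ λ i → Fresh i L
  freshEdge L short with any? (λ i → fresh? i L)
  ... | yes found = found
  ... | no  none  = ⊥-elim (collision (pigeonhole short position))
    where
      used : ∀ i → ∃ λ k → edgeAt L k ≡ i
      used i = [ (λ fresh → ⊥-elim (none (i , fresh))) , id ]′ (fresh-or-used i L)

      position : Fin m → Fin (length L)
      position i = proj₁ (used i)

      collision : ¬ ∃₂ λ i j → i <ᶠ j × position i ≡ position j
      collision (i , j , i<j , same) = <-irrefl (cong toℕ i≡j) i<j
        where
          i≡j : i ≡ j
          i≡j = trans (sym (proj₂ (used i))) (trans (cong (edgeAt L) same) (proj₂ (used j)))

  module Walks (x̂ : Endpoint) where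

    infixl 25 _‼_
    _‼_ : Trail → ℕ → Endpoint
    [] ‼ k = x̂
    (L ▷ p) ‼ k with k ≟ℕ length L
    ... | yes _ = p
    ... | no  _ = L ‼ k

    ‼-last : ∀ L p → (L ▷ p) ‼ length L ≡ p
    ‼-last L p with length L ≟ℕ length L
    ... | yes _ = refl
    ... | no ne = ⊥-elim (ne refl)

    ‼-init : ∀ L p k → k < length L → (L ▷ p) ‼ k ≡ L ‼ k
    ‼-init L p k k< with k ≟ℕ length L
    ... | yes refl = ⊥-elim (<-irrefl refl k<)
    ... | no  _    = refl

    -- Path L: L is an (x̂,M)-path, i.e. its last step leaves the matching edge it is on;
    -- Prefix L may moreover end by crossing a matching edge.
    mutual
      data Path : Trail → Set where
        start : Path ([] ▷ x̂)
        jump  : ∀ {L p} q → Prefix (L ▷ p) → p ~ q → Fresh (edgeOf q) (L ▷ p) → Path (L ▷ p ▷ q)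

      data Prefix : Trail → Set where
        noCross : ∀ {L} → Path L → Prefix L
        cross   : ∀ {L p} → Path (L ▷ p) → Prefix (L ▷ p ▷ partner p)

    cross′ : ∀ {L} q → Path (L ▷ partner q) → Prefix (L ▷ partner q ▷ q)
    cross′ {L} (i , s) π = subst (λ t → Prefix (L ▷ (i , not s) ▷ (i , t))) (not-involutive s) (cross π)

    Path⇒fresh : ∀ {L p} → Path (L ▷ p) → Fresh (edgeOf p) L
    Path⇒fresh start            = tt
    Path⇒fresh (jump _ _ _ fr) = fr

    fresh⇒edge≢ : ∀ {i} L a → Fresh i L → a < length L → edgeOf (L ‼ a) ≢ i
    fresh⇒edge≢ (L ▷ p) a (fr , i≢p) a< with <-cmp a (length L)
    ... | tri< a<L _ _ rewrite ‼-init L p a a<L = fresh⇒edge≢ L a fr a<L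
    ... | tri≈ _ refl _ rewrite ‼-last L p = ≢-sym i≢p
    ... | tri> _ _ L<a = ⊥-elim (<-irrefl refl (≤-trans a< L<a))

    record WellFormed (L : Trail) : Set where
      field
        starts   : L ‼ 0 ≡ x̂
        steps    : ∀ k → suc k < length L → L ‼ k ~ L ‼ suc k
        revisits : ∀ a b → a < b → b < length L → edgeOf (L ‼ a) ≡ edgeOf (L ‼ b) → b ≡ suc a
    open WellFormed

    wellFormed-▷ : ∀ L p q → WellFormed (L ▷ p) → p ~ q →
      (∀ a → a < suc (length L) → edgeOf ((L ▷ p) ‼ a) ≡ edgeOf q → a ≡ length L) →
      WellFormed (L ▷ p ▷ q)
    starts (wellFormed-▷ L p q wf _ _) = trans (‼-init (L ▷ p) q 0 (s≤s z≤n)) (starts wf)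
    steps (wellFormed-▷ L p q wf p~q _) k sk< with <-cmp (suc k) (suc (length L))
    ... | tri< sk<L _ _
      rewrite ‼-init (L ▷ p) q k (<-trans (n<1+n k) sk<L) | ‼-init (L ▷ p) q (suc k) sk<L = steps wf k sk<L
    ... | tri≈ _ refl _ rewrite ‼-init (L ▷ p) q k (n<1+n k) | ‼-last (L ▷ p) q | ‼-last L p = p~q
    ... | tri> _ _ L<sk = ⊥-elim (<-irrefl refl (≤-trans sk< L<sk))
    revisits (wellFormed-▷ L p q wf _ onlyAtP) a b a<b b< same with <-cmp b (suc (length L))
    ... | tri< b<L _ _
      rewrite ‼-init (L ▷ p) q a (<-trans a<b b<L) | ‼-init (L ▷ p) q b b<L = revisits wf a b a<b b<L same
    ... | tri≈ _ refl _ rewrite ‼-init (L ▷ p) q a a<b | ‼-last (L ▷ p) q = cong suc (sym (onlyAtP a a<b same))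
    ... | tri> _ _ L<b = ⊥-elim (<-irrefl refl (≤-trans b< L<b))

    mutual
      Path-wellFormed : ∀ {L} → Path L → WellFormed L
      starts (Path-wellFormed start) = refl
      steps (Path-wellFormed start) k (s≤s ())
      revisits (Path-wellFormed start) a b (s≤s _) (s≤s ()) _
      Path-wellFormed (jump {L} {p} q pre p~q fr) =
        wellFormed-▷ L p q (Prefix-wellFormed pre) p~q (λ a a< same → ⊥-elim (fresh⇒edge≢ (L ▷ p) a fr a< same))

      Prefix-wellFormed : ∀ {L} → Prefix L → WellFormed L
      Prefix-wellFormed (noCross π) = Path-wellFormed π
      Prefix-wellFormed (cross {L} {p} π) = wellFormed-▷ L p (partner p) (Path-wellFormed π) (~-partner p) onlyAtP
        where
          onlyAtP : ∀ a → a < suc (length L) → edgeOf ((L ▷ p) ‼ a) ≡ edgeOf p → a ≡ length L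
          onlyAtP a a< same with <-cmp a (length L)
          ... | tri< a<L _ _ rewrite ‼-init L p a a<L = ⊥-elim (fresh⇒edge≢ L a (Path⇒fresh π) a<L same)
          ... | tri≈ _ a≡L _ = a≡L
          ... | tri> _ _ L<a = ⊥-elim (<-irrefl refl (≤-trans a< L<a))

    no-return : ∀ {L} → WellFormed L → ∀ a b → a < b → b < length L → L ‼ a ≢ L ‼ b
    no-return {L} wf a b a<b b< e with revisits wf a b a<b b< (cong edgeOf e)
    ... | refl = ~-irrefl (subst (L ‼ a ~_) (sym e) (steps wf a b<))

    ‼-injective : ∀ {L} → WellFormed L → ∀ a b → a < length L → b < length L → L ‼ a ≡ L ‼ b → a ≡ b
    ‼-injective wf a b a< b< e with <-cmp a b
    ... | tri< a<b _ _ = ⊥-elim (no-return wf a b a<b b< e)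
    ... | tri≈ _ a≡b _ = a≡b
    ... | tri> _ _ b<a = ⊥-elim (no-return wf b a b<a a< (sym e))

    MEdge⇒consecutive : ∀ {L} → WellFormed L → ∀ a b → a < length L → b < length L →
      MEdge M (vertex (L ‼ a)) (vertex (L ‼ b)) → b ≡ suc a ⊎ a ≡ suc b
    MEdge⇒consecutive {L} wf a b a< b< me with <-cmp a b
    ... | tri< a<b _ _ = inj₁ (revisits wf a b a<b b< (MEdge⇒sameEdge (L ‼ a) (L ‼ b) me))
    ... | tri≈ _ refl _ = ⊥-elim (MEdge-irrefl me)
    ... | tri> _ _ b<a = inj₂ (revisits wf b a b<a a< (sym (MEdge⇒sameEdge (L ‼ a) (L ‼ b) me)))

    toXMPath : ∀ {L p q} → Path (L ▷ p ▷ q) → XMPath M (vertex x̂) (suc (length L))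
    toXMPath {L} {p} {q} π@(jump _ _ _ (_ , q≢p)) =
      w , w-injective , w-steps , (λ a → vertex∈VM (L′ ‼ toℕ a)) , cong vertex (starts wf) , last-step ,
      λ a b → MEdge⇒consecutive wf (toℕ a) (toℕ b) (toℕ<n a) (toℕ<n b)
      where
        L′ = L ▷ p ▷ q
        wf = Path-wellFormed π

        w : Fin (suc (suc (length L))) → Fin n
        w a = vertex (L′ ‼ toℕ a)

        w-injective : ∀ a b → w a ≡ w b → a ≡ b
        w-injective a b e =
          toℕ-injective (‼-injective wf (toℕ a) (toℕ b) (toℕ<n a) (toℕ<n b) (vertex-injective _ _ e))

        w-steps : ∀ i → Adj G (w (inject₁ i)) (w (suc i))
        w-steps i rewrite toℕ-inject₁ i = adjacent (steps wf (toℕ i) (s≤s (toℕ<n i)))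

        last-step : ∀ i → toℕ i ≡ length L → ¬ MEdge M (w (inject₁ i)) (w (suc i))
        last-step i i≡L
          rewrite toℕ-inject₁ i | i≡L | ‼-init (L ▷ p) q (length L) (n<1+n _) | ‼-last L p | ‼-last (L ▷ p) q =
          q≢p ∘ sym ∘ MEdge⇒sameEdge p q

    PathOfLength : ℕ → Set
    PathOfLength ℓ = Σ Trail λ L → Path L × length L ≡ suc ℓ

    viaJump : ∀ {L p q} → Prefix (L ▷ p) → p ~ q → Fresh (edgeOf q) (L ▷ p) → PathOfLength (suc (length L))
    viaJump pre p~q fr = _ , jump _ pre p~q fr , refl

    PathOfLength⇒XMPath : ∀ {ℓ} → PathOfLength (suc ℓ) → XMPath M (vertex x̂) (suc ℓ)
    PathOfLength⇒XMPath ([] , () , _)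
    PathOfLength⇒XMPath ([] ▷ _ , _ , ())
    PathOfLength⇒XMPath (L ▷ _ ▷ _ , π , L≡) = subst (XMPath M (vertex x̂)) (suc-injective L≡) (toXMPath π)

  module Construction (sc : StrongClique M) (x̂ : Endpoint) where
    open StrongCliqueFacts sc
    open Walks x̂

    -- Freshness proofs are named after what they exclude: fa : f ≢ edgeOf A, fP : Fresh f P, and so on.
    -- Reroutes are written as their last vertices, with A' = partner A, q' = partner q, etc.

    extend-through : ∀ {Q B q C j tj} → Prefix (Q ▷ B) → B ~ q → Fresh (edgeOf q) (Q ▷ B) →
      Fresh (edgeOf C) (Q ▷ B ▷ q) → ¬ C ⇝ edgeOf q → partner C ~ (j , tj) → Fresh j (Q ▷ B ▷ q ▷ C) →
      PathOfLength (3 + length Q)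
    extend-through {q = q} {C} pre B~q fq frC@(_ , cq) C↛q C'~j fj =
      -- B q C' j | B q q' C'
      [ (λ C'~q  → viaJump (noCross (jump (partner C) (noCross πq) (~-sym C'~q) frC)) C'~j fj)
      , (λ C'~q' → viaJump (cross πq) (~-sym C'~q') (frC , cq))
      ]′ (partner-sees C q cq C↛q)
      where πq = jump q pre B~q fq

    extend-ABC : ∀ {P A B C} → Path (P ▷ A) →
      A ~ B → Fresh (edgeOf B) (P ▷ A) →
      B ~ C → Fresh (edgeOf C) (P ▷ A ▷ B) →
      ∀ f → Fresh f (P ▷ A ▷ B ▷ C) → PathOfLength (3 + length P)
    extend-ABC {P} {A} {B} {C} πA A~B frB@(bP , ba) B~C frC@((cP , ca) , cb) f (((fP , fa) , fb) , fc) =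
      ifᵈ C ⇝? f then (λ (_ , C~f) → viaJump (noCross πC) C~f (((fP , fa) , fb) , fc)) else λ C↛f →
      [ B-sees C↛f
      , (λ (_ , B'~f) → viaJump (cross πB) B'~f (((fP , fa) , fb) , fb))
      ]′ (sees-or-partner-sees B f bf)
      where
        af = ≢-sym fa
        bf = ≢-sym fb
        cf = ≢-sym fc
        πB = jump B (noCross πA) A~B frB
        πC = jump C (noCross πB) B~C frC

        B-sees : ¬ C ⇝ f → B ⇝ f → PathOfLength (3 + length P)
        B-sees C↛f (t , B~q) =
          [ (λ C'~q → viaJump (noCross (jump q (noCross πB) B~q ((fP , fa) , fb))) (~-sym C'~q) (frC , cf))
          -- A q B C | A q' q B | A A' q B | A A' q' C'
          , (λ C'~q' → joined A q af
              (λ A~q → viaJump (noCross (jump B (noCross (jump q (noCross πA) A~q (fP , fa))) (~-sym B~q)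
                                                 ((bP , ba) , bf)))
                                B~C (((cP , ca) , cf) , cb))
              (λ A~q' → viaJump (cross′ q (jump (partner q) (noCross πA) A~q' (fP , fa))) (~-sym B~q)
                                 (((bP , ba) , bf) , bf))
              (λ A'~q → viaJump (noCross (jump q (cross πA) A'~q ((fP , fa) , fa))) (~-sym B~q)
                                 (((bP , ba) , ba) , bf))
              (λ A'~q' → viaJump (noCross (jump (partner q) (cross πA) A'~q' ((fP , fa) , fa))) (~-sym C'~q')
                                  (((cP , ca) , ca) , cf)))
          ]′ (partner-sees C q cf C↛f)
          where q = f , t

    extend-AA'BC : ∀ {P A B C} → Path (P ▷ A) →
      partner A ~ B → Fresh (edgeOf B) (P ▷ A ▷ partner A) →
      B ~ C → Fresh (edgeOf C) (P ▷ A ▷ partner A ▷ B) →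
      ∀ f g → Fresh f (P ▷ A ▷ B ▷ C) → Fresh g (P ▷ A ▷ B ▷ C) → g ≢ f → PathOfLength (4 + length P)
    extend-AA'BC {P} {A} {B} {C} πA A'~B frB@((bP , ba) , _) B~C frC@(((cP , ca) , _) , cb)
                 f g (((fP , fa) , fb) , fc) (((gP , ga) , gb) , gc) gf =
      ifᵈ C ⇝? f then (λ (_ , C~f) → viaJump (noCross πC) C~f ((((fP , fa) , fa) , fb) , fc)) else λ C↛f →
      ifᵈ C ⇝? g then (λ (_ , C~g) → viaJump (noCross πC) C~g ((((gP , ga) , ga) , gb) , gc)) else λ C↛g →
      [ B-sees C↛f (partner-sees-edge C g cg C↛g)
      , (λ (_ , B'~f) → viaJump (cross πB) B'~f ((((fP , fa) , fa) , fb) , fb))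
      ]′ (sees-or-partner-sees B f bf)
      where
        af = ≢-sym fa
        bf = ≢-sym fb
        cf = ≢-sym fc
        cg = ≢-sym gc
        πB = jump B (cross πA) A'~B frB
        πC = jump C (noCross πB) B~C frC

        B-sees : ¬ C ⇝ f → partner C ⇝ g → B ⇝ f → PathOfLength (4 + length P)
        B-sees C↛f (_ , C'~g) (t , B~q) =
          [ (λ C'~q → viaJump (noCross (jump q (noCross πB) B~q (((fP , fa) , fa) , fb))) (~-sym C'~q) (frC , cf))
          -- A q q' C' g | A q' q B C | A A' q q' C' | A A' q' q B
          , (λ C'~q' → joined A q af
              (λ A~q → viaJump (noCross (jump (partner C) (cross (jump q (noCross πA) A~q (fP , fa))) (~-sym C'~q')
                                                 (((cP , ca) , cf) , cf)))
                                C'~g ((((gP , ga) , gf) , gf) , gc))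
              (λ A~q' → viaJump (noCross (jump B (cross′ q (jump (partner q) (noCross πA) A~q' (fP , fa))) (~-sym B~q)
                                                 (((bP , ba) , bf) , bf)))
                                 B~C ((((cP , ca) , cf) , cf) , cb))
              (λ A'~q → viaJump (cross (jump q (cross πA) A'~q ((fP , fa) , fa))) (~-sym C'~q')
                                 ((((cP , ca) , ca) , cf) , cf))
              (λ A'~q' → viaJump (cross′ q (jump (partner q) (cross πA) A'~q' ((fP , fa) , fa))) (~-sym B~q)
                                  ((((bP , ba) , ba) , bf) , bf)))
          ]′ (partner-sees C q cf C↛f)
          where q = f , t

    extend-ABB'C : ∀ {P A B C} → Path (P ▷ A) →
      A ~ B → Fresh (edgeOf B) (P ▷ A) →
      partner B ~ C → Fresh (edgeOf C) (P ▷ A ▷ B ▷ partner B) →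
      ∀ f g → Fresh f (P ▷ A ▷ B ▷ C) → Fresh g (P ▷ A ▷ B ▷ C) → g ≢ f → PathOfLength (4 + length P)
    extend-ABB'C {P} {A} {B} {C} πA A~B frB@(bP , ba) B'~C frC@(((cP , ca) , cb) , _)
                 f g (((fP , fa) , fb) , fc) (((gP , ga) , gb) , gc) gf =
      ifᵈ C ⇝? f then (λ (_ , C~f) → viaJump (noCross πC) C~f ((((fP , fa) , fb) , fb) , fc)) else λ C↛f →
      ifᵈ C ⇝? g then (λ (_ , C~g) → viaJump (noCross πC) C~g ((((gP , ga) , gb) , gb) , gc)) else λ C↛g →
      let (_ , C'~g) = partner-sees-edge C g cg C↛g in
      [ (λ (_ , B~q) → extend-through (noCross πB) B~q ((fP , fa) , fb) (((cP , ca) , cb) , cf) C↛f C'~g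
                                      ((((gP , ga) , gb) , gf) , gc))
      , B'-sees C↛f C'~g
      ]′ (sees-or-partner-sees B f bf)
      where
        af = ≢-sym fa
        bf = ≢-sym fb
        cf = ≢-sym fc
        cg = ≢-sym gc
        πB = jump B (noCross πA) A~B frB
        πC = jump C (cross πB) B'~C frC

        B'-sees : ∀ {tg} → ¬ C ⇝ f → partner C ~ (g , tg) → partner B ⇝ f → PathOfLength (4 + length P)
        B'-sees C↛f C'~g (t , B'~q) =
          [ (λ C'~q → viaJump (noCross (jump q (cross πB) B'~q (((fP , fa) , fb) , fb))) (~-sym C'~q)
                               ((((cP , ca) , cb) , cb) , cf))
          -- A q q' C' g | A q' q B' C | A A' q B' C | A A' q' C' g
          , (λ C'~q' → joined A q af
              (λ A~q → viaJump (noCross (jump (partner C) (cross (jump q (noCross πA) A~q (fP , fa))) (~-sym C'~q')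
                                                 (((cP , ca) , cf) , cf)))
                                C'~g ((((gP , ga) , gf) , gf) , gc))
              (λ A~q' → viaJump (noCross (jump (partner B) (cross′ q (jump (partner q) (noCross πA) A~q' (fP , fa)))
                                                 (~-sym B'~q) (((bP , ba) , bf) , bf)))
                                 B'~C ((((cP , ca) , cf) , cf) , cb))
              (λ A'~q → viaJump (noCross (jump (partner B) (noCross (jump q (cross πA) A'~q ((fP , fa) , fa)))
                                                 (~-sym B'~q) (((bP , ba) , ba) , bf)))
                                 B'~C ((((cP , ca) , ca) , cf) , cb))
              (λ A'~q' → viaJump (noCross (jump (partner C) (noCross (jump (partner q) (cross πA) A'~q' ((fP , fa) , fa)))
                                                  (~-sym C'~q') (((cP , ca) , ca) , cf)))
                                  C'~g ((((gP , ga) , ga) , gf) , gc)))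
          ]′ (partner-sees C q cf C↛f)
          where q = f , t

    extend-AA'BB'C : ∀ {P A B C} → Path (P ▷ A) →
      partner A ~ B → Fresh (edgeOf B) (P ▷ A ▷ partner A) →
      partner B ~ C → Fresh (edgeOf C) (P ▷ A ▷ partner A ▷ B ▷ partner B) →
      ∀ f g → Fresh f (P ▷ A ▷ B ▷ C) → Fresh g (P ▷ A ▷ B ▷ C) → g ≢ f → PathOfLength (5 + length P)
    extend-AA'BB'C {P} {A} {B} {C} πA A'~B frB@((bP , ba) , _) B'~C frC@((((cP , ca) , _) , cb) , _)
                   f g (((fP , fa) , fb) , fc) (((gP , ga) , gb) , gc) gf =
      ifᵈ C ⇝? f then (λ (_ , C~f) → viaJump (noCross πC) C~f (((((fP , fa) , fa) , fb) , fb) , fc)) else λ C↛f →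
      ifᵈ C ⇝? g then (λ (_ , C~g) → viaJump (noCross πC) C~g (((((gP , ga) , ga) , gb) , gb) , gc)) else λ C↛g →
      let (_ , C'~f) = partner-sees-edge C f cf C↛f
          (_ , C'~g) = partner-sees-edge C g cg C↛g in
      ifᵈ B ⇝? f then (λ (_ , B~q) → extend-through (noCross πB) B~q (((fP , fa) , fa) , fb)
                                        ((((cP , ca) , ca) , cb) , cf) C↛f C'~g (((((gP , ga) , ga) , gb) , gf) , gc))
      else λ B↛f →
      ifᵈ B ⇝? g then (λ (_ , B~s) → extend-through (noCross πB) B~s (((gP , ga) , ga) , gb)
                                        ((((cP , ca) , ca) , cb) , cg) C↛g C'~f (((((fP , fa) , fa) , fb) , fg) , fc))
      else λ B↛g →
      B'-sees C↛f C↛g C'~g (partner-sees-edge B f bf B↛f) (partner-sees-edge B g bg B↛g)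
      where
        af = ≢-sym fa
        bf = ≢-sym fb
        bg = ≢-sym gb
        cf = ≢-sym fc
        cg = ≢-sym gc
        fg = ≢-sym gf
        πB = jump B (cross πA) A'~B frB
        πC = jump C (cross πB) B'~C frC

        B'-sees : ∀ {tg} → ¬ C ⇝ f → ¬ C ⇝ g → partner C ~ (g , tg) → partner B ⇝ f → partner B ⇝ g →
                  PathOfLength (5 + length P)
        B'-sees C↛f C↛g C'~g (tq , B'~q) (ts , B'~s) =
          ifᵈ q ⇝? g then (λ (_ , q~g) → viaJump (noCross πq) q~g (((((gP , ga) , ga) , gb) , gb) , gf)) else λ q↛g →
          ifᵈ s ⇝? f then (λ (_ , s~f) → viaJump (noCross πs) s~f (((((fP , fa) , fa) , fb) , fb) , fg)) else λ s↛f →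
          [ (λ C'~q → viaJump (noCross πq) (~-sym C'~q) (((((cP , ca) , ca) , cb) , cb) , cf))
          , (λ C'~q' →
          [ (λ C'~s → viaJump (noCross πs) (~-sym C'~s) (((((cP , ca) , ca) , cb) , cb) , cg))
          , (λ C'~s' → reroute C'~q' C'~s' C'~g
                         ([ (λ q'~s → ⊥-elim (s↛f (_ , ~-sym q'~s))) , id ]′ (partner-sees q s fg q↛g)))
          ]′ (partner-sees C s cg C↛g))
          ]′ (partner-sees C q cf C↛f)
          where
            q = f , tq
            s = g , ts
            πq = jump q (cross πB) B'~q ((((fP , fa) , fa) , fb) , fb)
            πs = jump s (cross πB) B'~s ((((gP , ga) , ga) , gb) , gb)

            -- A q B' s s' C' | A q' s' s B' C | A A' q q' C' g | A A' q' q B' C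
            reroute : ∀ {tg} → partner C ~ partner q → partner C ~ partner s → partner C ~ (g , tg) →
                      partner q ~ partner s → PathOfLength (5 + length P)
            reroute C'~q' C'~s' C'~g q'~s' = joined A q af
              (λ A~q → viaJump (cross (jump s (noCross (jump (partner B) (noCross (jump q (noCross πA) A~q (fP , fa)))
                                                           (~-sym B'~q) ((bP , ba) , bf)))
                                             B'~s (((gP , ga) , gf) , gb)))
                                (~-sym C'~s') (((((cP , ca) , cf) , cb) , cg) , cg))
              (λ A~q' → viaJump (noCross (jump (partner B) (cross′ s (jump (partner s)
                                                  (noCross (jump (partner q) (noCross πA) A~q' (fP , fa)))
                                                  q'~s' ((gP , ga) , gf)))
                                                 (~-sym B'~s) ((((bP , ba) , bf) , bg) , bg)))
                                 B'~C (((((cP , ca) , cf) , cg) , cg) , cb))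
              (λ A'~q → viaJump (noCross (jump (partner C) (cross (jump q (cross πA) A'~q ((fP , fa) , fa))) (~-sym C'~q')
                                                 ((((cP , ca) , ca) , cf) , cf)))
                                 C'~g (((((gP , ga) , ga) , gf) , gf) , gc))
              (λ A'~q' → viaJump (noCross (jump (partner B) (cross′ q (jump (partner q) (cross πA) A'~q' ((fP , fa) , fa)))
                                                  (~-sym B'~q) ((((bP , ba) , ba) , bf) , bf)))
                                  B'~C (((((cP , ca) , ca) , cf) , cf) , cb))

    twoFreshEdges : ∀ L → suc (length L) < m → Σ (Fin m) λ f → Σ (Fin m) λ g → Fresh f L × Fresh g L × g ≢ f
    twoFreshEdges L short with freshEdge L (<-trans (n<1+n _) short)
    ... | f , fL with freshEdge (L ▷ (f , true)) short
    ...   | g , gL , gf = f , g , fL , gL , gf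

    extend-path : ∀ {L} → Path L → 4 ≤ length L → length L < m → PathOfLength (length L)
    extend-path start (s≤s ()) _
    extend-path (jump _ (noCross start) _ _) (s≤s (s≤s ())) _
    extend-path (jump _ (cross start) _ _) (s≤s (s≤s (s≤s ()))) _
    extend-path {P ▷ A ▷ B ▷ C} (jump C (noCross (jump B (noCross πA) A~B frB)) B~C frC) _ short =
      let (f , fL) = freshEdge (P ▷ A ▷ B ▷ C) short in
      extend-ABC πA A~B frB B~C frC f fL
    extend-path {P ▷ A ▷ _ ▷ B ▷ C} (jump C (noCross (jump B (cross πA) A'~B frB)) B~C frC) _ short =
      let (f , g , fL , gL , gf) = twoFreshEdges (P ▷ A ▷ B ▷ C) short in
      extend-AA'BC πA A'~B frB B~C frC f g fL gL gf
    extend-path {P ▷ A ▷ B ▷ _ ▷ C} (jump C (cross (jump B (noCross πA) A~B frB)) B'~C frC) _ short =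
      let (f , g , fL , gL , gf) = twoFreshEdges (P ▷ A ▷ B ▷ C) short in
      extend-ABB'C πA A~B frB B'~C frC f g fL gL gf
    extend-path {P ▷ A ▷ _ ▷ B ▷ _ ▷ C} (jump C (cross (jump B (cross πA) A'~B frB)) B'~C frC) _ short =
      let (f , g , fL , gL , gf) = twoFreshEdges (P ▷ A ▷ B ▷ C) (<-trans (n<1+n _) short) in
      extend-AA'BB'C πA A'~B frB B'~C frC f g fL gL gf

    extend : ∀ {ℓ} → 3 ≤ ℓ → suc ℓ < m → PathOfLength ℓ → PathOfLength (suc ℓ)
    extend 3≤ℓ short (L , π , L≡) =
      subst PathOfLength L≡ (extend-path π (subst (4 ≤_) (sym L≡) (s≤s 3≤ℓ)) (subst (_< m) (sym L≡) short))

    o : Fin m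
    o = edgeOf x̂

    TwoJumps : Set
    TwoJumps = Σ Endpoint λ z → Σ Endpoint λ w →
      edgeOf z ≢ o × x̂ ~ z × edgeOf w ≢ o × edgeOf w ≢ edgeOf z × z ~ w

    twoJumps? : Dec TwoJumps
    twoJumps? = anyEndpoint? λ z → anyEndpoint? λ w →
      ¬? (edgeOf z ≟ᶠ o) ×-dec x̂ ~? z ×-dec ¬? (edgeOf w ≟ᶠ o) ×-dec ¬? (edgeOf w ≟ᶠ edgeOf z) ×-dec z ~? w

    module _ (3≤m : 3 ≤ m) (x̂'-blind : ∀ w → edgeOf w ≢ o → ¬ partner x̂ ~ w) (no-two-jumps : ¬ TwoJumps) where

      x̂-sees : ∀ j → j ≢ o → x̂ ⇝ j
      x̂-sees j j≢o = sees-edge x̂ j (j≢o ∘ sym) (λ (t , h) → x̂'-blind (j , t) j≢o h)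

      x̂-sees-one : ∀ j → j ≢ o → ∀ s → x̂ ~ (j , s) → ¬ x̂ ~ (j , not s)
      x̂-sees-one j j≢o s x̂~s x̂~¬s with freshEdge ([] ▷ x̂ ▷ (j , s)) 3≤m
      ... | k , (_ , k≢o) , k≢j with linked j k (≢-sym k≢j)
      ...   | s′ , t , h = no-two-jumps ((j , s′) , (k , t) , j≢o , x̂~ s′ , k≢o , k≢j , h)
        where
          x̂~ : ∀ s′ → x̂ ~ (j , s′)
          x̂~ s′ with ≡-or-≡-not s′ s
          ... | inj₁ refl = x̂~s
          ... | inj₂ refl = x̂~¬s

      side : Fin m → Bool
      side j with j ≟ᶠ o
      ... | yes _   = proj₂ x̂
      ... | no  j≢o = proj₁ (x̂-sees j j≢o)

      near far : Fin m → Endpoint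
      near j = j , side j
      far j = partner (near j)

      near-o : near o ≡ x̂
      near-o with o ≟ᶠ o
      ... | yes _ = refl
      ... | no o≢o = ⊥-elim (o≢o refl)

      x̂~near : ∀ j → j ≢ o → x̂ ~ near j
      x̂~near j j≢o with j ≟ᶠ o
      ... | yes j≡o = ⊥-elim (j≢o j≡o)
      ... | no  j≢o′ = proj₂ (x̂-sees j j≢o′)

      near-blind : ∀ i j → i ≢ o → j ≢ o → i ≢ j → ∀ t → ¬ near i ~ (j , t)
      near-blind i j i≢o j≢o i≢j t h = no-two-jumps (near i , (j , t) , i≢o , x̂~near i i≢o , j≢o , ≢-sym i≢j , h)

      special : XSpecial M (vertex x̂)
      special = o , vertex ∘ near , vertex ∘ far , MEdge-partner ∘ near , (λ i → i , endpoints i (side i)) ,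
                cong vertex near-o , centre , near-independent , far-clique , far-o , near-far
        where
          endpoints : ∀ i s → (u M i ≡ vertex (i , s) × v M i ≡ vertex (i , not s)) ⊎
                              (u M i ≡ vertex (i , not s) × v M i ≡ vertex (i , s))
          endpoints i true  = inj₁ (refl , refl)
          endpoints i false = inj₂ (refl , refl)

          centre : ∀ j → j ≢ o → Adj G (vertex (near o)) (vertex (near j))
          centre j j≢o = adjacent (subst (_~ near j) (sym near-o) (x̂~near j j≢o))

          near-independent : ∀ i j → i ≢ o → j ≢ o → i ≢ j → ¬ Adj G (vertex (near i)) (vertex (near j))
          near-independent i j i≢o j≢o i≢j h = near-blind i j i≢o j≢o i≢j (side j) ⟨ h ⟩

          far-clique : ∀ i j → i ≢ o → j ≢ o → i ≢ j → Adj G (vertex (far i)) (vertex (far j))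
          far-clique i j i≢o j≢o i≢j with sees-or-partner-sees (near i) j i≢j
          ... | inj₁ (t , h) = ⊥-elim (near-blind i j i≢o j≢o i≢j t h)
          ... | inj₂ far-i⇝j with ⇝-split (near j) far-i⇝j
          ...   | inj₁ h = ⊥-elim (near-blind j i j≢o i≢o (≢-sym i≢j) _ (~-sym h))
          ...   | inj₂ h = adjacent h

          far-o : ∀ j → j ≢ o → ¬ Adj G (vertex (far o)) (vertex (far j))
          far-o j j≢o h = x̂'-blind (far j) j≢o (subst (λ e → partner e ~ far j) near-o ⟨ h ⟩)

          near-far : ∀ i j → i ≢ j → ¬ Adj G (vertex (near i)) (vertex (far j))
          near-far i j i≢j h = by-cases (i ≟ᶠ o) (j ≟ᶠ o)
            where
              by-cases : Dec (i ≡ o) → Dec (j ≡ o) → ⊥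
              by-cases (yes i≡o) _ =
                x̂-sees-one j j≢o (side j) (x̂~near j j≢o) (subst (_~ far j) (trans (cong near i≡o) near-o) ⟨ h ⟩)
                where j≢o = λ j≡o → i≢j (trans i≡o (sym j≡o))
              by-cases (no i≢o) (yes j≡o) =
                x̂'-blind (near i) i≢o (~-sym (subst (λ e → near i ~ partner e) (trans (cong near j≡o) near-o) ⟨ h ⟩))
              by-cases (no i≢o) (no j≢o) = near-blind i j i≢o j≢o i≢j (not (side j)) ⟨ h ⟩

    length-two : 3 ≤ m → ¬ XSpecial M (vertex x̂) → PathOfLength 2
    length-two 3≤m not-special with anyEndpoint? (λ w → ¬? (edgeOf w ≟ᶠ o) ×-dec partner x̂ ~? w)
    ... | yes (w , w≢o , x̂'~w) = viaJump (cross start) x̂'~w ((tt , w≢o) , w≢o)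
    ... | no  x̂'-blind with twoJumps?
    ...   | yes (z , w , z≢o , x̂~z , w≢o , w≢z , z~w) =
            viaJump (noCross (jump z (noCross start) x̂~z (tt , z≢o))) z~w ((tt , w≢o) , w≢z)
    ...   | no  no-two-jumps =
            ⊥-elim (not-special (special 3≤m (λ w w≢o x̂'~w → x̂'-blind (w , w≢o , x̂'~w)) no-two-jumps))

    length-three : 4 ≤ m → ∀ y → x̂ ~ y → edgeOf y ≢ o → PathOfLength 3
    length-three 4≤m y x̂~y y≢o with twoJumps?
    ... | yes (z , w , z≢o , x̂~z , w≢o , w≢z , z~w) =
          let (f , fL) = freshEdge ([] ▷ x̂ ▷ z ▷ w) 4≤m in
          extend-ABC start x̂~z (tt , z≢o) z~w ((tt , w≢o) , w≢z) f fL
    ... | no  no-two-jumps =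
          let (k , (_ , k≢o) , k≢y) = freshEdge ([] ▷ x̂ ▷ y) (≤-trans (n≤1+n 3) 4≤m)
              (_ , y'~k) = partner-sees-edge y k (≢-sym k≢y)
                             (λ (t , y~k) → no-two-jumps (y , (k , t) , y≢o , x̂~y , k≢o , k≢y , y~k))
          in viaJump (cross (jump y (noCross start) x̂~y (tt , y≢o))) y'~k (((tt , k≢o) , k≢y) , k≢y)

    module _ (y : Endpoint) (x̂~y : x̂ ~ y) (y≢o : edgeOf y ≢ o) (not-special : ¬ XSpecial M (vertex x̂)) where

      paths : ∀ ℓ → 1 ≤ ℓ → ℓ < m → PathOfLength ℓ
      paths 0 () _
      paths 1 _ _   = viaJump (noCross start) x̂~y (tt , y≢o)
      paths 2 _ 2<m = length-two 2<m not-special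
      paths 3 _ 3<m = length-three 3<m y x̂~y y≢o
      paths (suc (suc (suc (suc k)))) _ ℓ<m =
        extend (s≤s (s≤s (s≤s z≤n))) ℓ<m (paths (suc (suc (suc k))) (s≤s z≤n) (<-trans (n<1+n _) ℓ<m))

lemma4p2 : ∀ {n : ℕ} (G : Graph n) (m : ℕ) (M : Matching G m) →
    2 ≤ m → StrongClique M → (x : Fin n) → InVM M x → ¬ XSpecial M x →
    (Σ (Fin n) λ y → InVM M y × Adj G x y × y ≢ x × ¬ MEdge M x y) →
    ∀ (ℓ : ℕ) → 1 ≤ ℓ → ℓ ≤ m ∸ 1 → XMPath M x ℓ
-- The hypothesis 2 ≤ m is implied by 1 ≤ ℓ ≤ m ∸ 1.
lemma4p2 G (suc m) M _ sc x x∈M not-special (y , y∈M , x~y , y≢x , ¬xMy) (suc ℓ) _ ℓ<m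
  with endpointOf M x∈M | endpointOf M y∈M
... | x̂ , refl | ŷ , refl =
  PathOfLength⇒XMPath (paths ŷ ⟨ x~y ⟩ (distinctEdges M x̂ ŷ y≢x ¬xMy) not-special (suc ℓ) (s≤s z≤n) (s≤s ℓ<m))
  where
    open Walks M x̂
    open Construction M sc x̂
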